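{- In the ring $\Lambda_{\mathbb{Q}}[[q,t]]$ of formal power series in $q,t$ with coefficients in $\Lambda_{\mathbb{Q}}$, one has the factorization \[ E(t)=\sum_{n\ge0}e_nt^n=\prod_{k=0}^{\infty}\big(1-(1-q)(q^kt)\,p_q(-q^kt)\big)^{ -1}=\prod_{k=0}^{\infty}\Big(1+(1-q)\sum_{n\geq1}[p_n]_q(-q^kt)^n\Big)^{ -1}, \] where the series and the products converge formally.
   Context: $\Lambda_{\mathbb{Q}}$ is the algebra of symmetric functions in $x_1,x_2,\dots$ over $\mathbb{Q}$, $e_n$ the elementary symmetric functions ($e_0=1$), $E(t)=\sum_{n\ge0}e_nt^n$. $q$ is an indeterminate, $[n]_q=1+q+\cdots+q^{n-1}$, $D_qF(t)=\frac{F(qt)-F(t)}{(q-1)t}$. The $q$-power sums $[p_n]_q$ ($n\ge1$) are defined by $\sum_{n\geq1}[p_n]_q(-t)^{n-1}=D_qE(t)/E(t)$; each $[p_n]_q$ is a polynomial in $q$ with coefficients in $\Lambda_{\mathbb{Q}}$. Set $p_q(t)=\sum_{n\ge0}[p_{n+1}]_qt^n$. Formal convergence refers to the topology of the $(q,t)$-adic valuation. -}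

module Defs where

open import Level using (_⊔_)
open import Data.Nat using (ℕ; zero; suc; _∸_; _≤ᵇ_; _<ᵇ_; _≡ᵇ_) renaming (_+_ to _+ℕ_; _*_ to _*ℕ_)
open import Data.Bool using (if_then_else_)
open import Data.Product using (_×_; ∃-syntax)
open import Data.Nat using (_≤_)
open import Algebra.Bundles using (CommutativeRing)
open import Algebra.Morphism.Structures using (module RingMorphisms)
open import Data.Rational using (ℚ)
import Data.Rational.Properties as ℚP

IsQAlgebraStructure : ∀ {c ℓ} (R : CommutativeRing c ℓ) → (ℚ → CommutativeRing.Carrier R) → Set ℓ
IsQAlgebraStructure R ι =
  RingMorphisms.IsRingHomomorphism
    (CommutativeRing.rawRing ℚP.+-*-commutativeRing) (CommutativeRing.rawRing R) ι

-- Formal power series in q, t over the commutative ring R, with a fixed sequence e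
-- playing the role of the elementary symmetric functions (e 0 = 1).
-- A series f is given by its coefficients: f i j = coefficient of q^i t^j.
module PowerSeries {c ℓ} (R : CommutativeRing c ℓ) (e : ℕ → CommutativeRing.Carrier R) where
  open CommutativeRing R

  PS : Set c
  PS = ℕ → ℕ → Carrier

  ∑≤ : ℕ → (ℕ → Carrier) → Carrier
  ∑≤ zero f = f 0
  ∑≤ (suc n) f = ∑≤ n f + f (suc n)

  _^ᴿ_ : Carrier → ℕ → Carrier
  x ^ᴿ zero = 1#
  x ^ᴿ suc n = x * (x ^ᴿ n)

  one : PS
  one zero zero = 1#
  one _ _ = 0#

  _⊕_ : PS → PS → PS
  (f ⊕ g) i j = f i j + g i j

  ⊝_ : PS → PS
  (⊝ f) i j = - f i j

  _⊛_ : PS → PS → PS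
  (f ⊛ g) i j = ∑≤ i λ a → ∑≤ j λ b → f a b * g (i ∸ a) (j ∸ b)

  pow : PS → ℕ → PS
  pow f zero = one
  pow f (suc m) = f ⊛ pow f m

  -- inverse of a series with constant term 1: f⁻¹ = Σ_m (1 - f)^m
  -- (the coefficient of q^i t^j only receives contributions from m ≤ i + j)
  inv : PS → PS
  inv f i j = ∑≤ (i +ℕ j) λ m → pow (one ⊕ (⊝ f)) m i j

  mono : ℕ → ℕ → PS
  mono a b i j = if (i ≡ᵇ a) then (if (j ≡ᵇ b) then 1# else 0#) else 0#

  -- the substitution t ↦ c q^k t :  f(q, c q^k t)
  subst : ℕ → Carrier → PS → PS
  subst k x f i j = if (k *ℕ j ≤ᵇ i) then (x ^ᴿ j) * f (i ∸ (k *ℕ j)) j else 0#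

  E : PS
  E zero j = e j
  E (suc i) j = 0#

  -- coefficient of q^i in [n]_q
  qint : ℕ → ℕ → Carrier
  qint n i = if (i <ᵇ n) then 1# else 0#

  -- D_q E(t) = Σ_{n≥1} e_n [n]_q t^(n-1)
  DqE : PS
  DqE i j = e (suc j) * qint (suc j) i

  -- D_q E(t) / E(t) = Σ_{n≥1} [p_n]_q (-t)^(n-1)
  DqE/E : PS
  DqE/E = DqE ⊛ inv E

  -- qp n i = coefficient of q^i in [p_n]_q   (n ≥ 1; the value at n = 0 is unused)
  qp : ℕ → ℕ → Carrier
  qp zero i = 0#
  qp (suc j) i = ((- 1#) ^ᴿ j) * DqE/E i j

  -- p_q(t) = Σ_{n≥0} [p_{n+1}]_q t^n
  pq : PS
  pq i j = qp (suc j) i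

  oneMinusQ : PS
  oneMinusQ = one ⊕ (⊝ mono 1 0)

  -- k-th factor (before inversion) of the first product:  1 - (1-q)(q^k t) p_q(-q^k t)
  F : ℕ → PS
  F k = one ⊕ (⊝ (oneMinusQ ⊛ (mono k 1 ⊛ subst k (- 1#) pq)))

  Pser : PS
  Pser i zero = 0#
  Pser i (suc j) = qp (suc j) i

  -- k-th factor (before inversion) of the second product: 1 + (1-q) Σ_{n≥1} [p_n]_q (-q^k t)^n
  G : ℕ → PS
  G k = one ⊕ (oneMinusQ ⊛ subst k (- 1#) Pser)

  prod : (ℕ → PS) → ℕ → PS
  prod f zero = one
  prod f (suc K) = prod f K ⊛ f K

  -- formal convergence of the partial products Π_{k<K} f k to the limit L:
  -- every coefficient of the partial products is eventually equal to that of L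
  -- (equivalent to convergence in the (q,t)-adic topology).
  ProdConvergesTo : (ℕ → PS) → PS → Set ℓ
  ProdConvergesTo f L = ∀ i j → ∃[ K₀ ] (∀ K → K₀ ≤ K → prod f K i j ≈ L i j)

{-# OPTIONS --safe #-}
-- With F₀(t) = 1 - (1 - q) t p_q(-t) and p_q(-t) = D_q E(t) / E(t), the q-difference identity
-- (1 - q) t D_q E(t) = E(t) - E(qt) gives E(t) F₀(t) = E(qt). Both products have k-th factor
-- F₀(qᵏ t)⁻¹, so the K-th partial product telescopes to E(t) / E(qᴷ t), and E(qᴷ t) ≡ 1 modulo qᴷ.
-- Series in q and t are modelled as R[[q]][[t]], the one-variable construction applied twice.
module Submission where

open import Defs
open import Algebra.Bundles using (CommutativeRing; Semiring)
open import Data.Nat using (ℕ; zero; suc; _∸_; _≤_; _<_; z≤n; s≤s; s≤s⁻¹; _≤ᵇ_; _≡ᵇ_)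
  renaming (_+_ to _+ℕ_; _*_ to _*ℕ_)
import Data.Nat.Properties as ℕ
open import Data.Bool using (true; false; if_then_else_)
open import Data.Bool.Properties using (if-eta)
open import Data.Product using (_×_; _,_)
open import Data.Rational using (ℚ)
open import Data.Sum using (inj₁; inj₂)
open import Relation.Binary.PropositionalEquality using (_≡_; cong)
  renaming (refl to ≡-refl; sym to ≡-sym; trans to ≡-trans)
import Algebra.Construct.Pointwise as Pointwise
import Algebra.Definitions.RawSemiring as RawSemiringDefinitions
import Algebra.Properties.Ring as RingProperties
import Algebra.Properties.CommutativeSemigroup as CommutativeSemigroupProperties
import Relation.Binary.Reasoning.Setoid as SetoidReasoning

module FiniteSums {c ℓ} (R : CommutativeRing c ℓ) where
  open CommutativeRing R
  open SetoidReasoning setoid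
  open RingProperties ring using (x[y-z]≈xy-xz)
  open CommutativeSemigroupProperties +-commutativeSemigroup using () renaming (interchange to +-interchange)
  open RawSemiringDefinitions (Semiring.rawSemiring semiring) public using (_^_)

  ∑ : ℕ → (ℕ → Carrier) → Carrier
  ∑ zero f = f 0
  ∑ (suc n) f = ∑ n f + f (suc n)

  ∑-cong-≤ : ∀ n {f g : ℕ → Carrier} → (∀ a → a ≤ n → f a ≈ g a) → ∑ n f ≈ ∑ n g
  ∑-cong-≤ zero f≈g = f≈g 0 z≤n
  ∑-cong-≤ (suc n) f≈g = +-cong (∑-cong-≤ n (λ a a≤n → f≈g a (ℕ.m≤n⇒m≤1+n a≤n))) (f≈g (suc n) ℕ.≤-refl)

  ∑-cong : ∀ n {f g : ℕ → Carrier} → (∀ a → f a ≈ g a) → ∑ n f ≈ ∑ n g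
  ∑-cong n f≈g = ∑-cong-≤ n (λ a _ → f≈g a)

  ∑-distrib-+ : ∀ n f g → ∑ n (λ a → f a + g a) ≈ ∑ n f + ∑ n g
  ∑-distrib-+ zero f g = refl
  ∑-distrib-+ (suc n) f g = trans (+-congʳ (∑-distrib-+ n f g)) (+-interchange _ _ _ _)

  *-distribˡ-∑ : ∀ n x f → x * ∑ n f ≈ ∑ n (λ a → x * f a)
  *-distribˡ-∑ zero x f = refl
  *-distribˡ-∑ (suc n) x f = trans (distribˡ x _ _) (+-congʳ (*-distribˡ-∑ n x f))

  *-distribʳ-∑ : ∀ n x f → ∑ n f * x ≈ ∑ n (λ a → f a * x)
  *-distribʳ-∑ zero x f = refl
  *-distribʳ-∑ (suc n) x f = trans (distribʳ x _ _) (+-congʳ (*-distribʳ-∑ n x f))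

  ∑-zero : ∀ n f → (∀ a → a ≤ n → f a ≈ 0#) → ∑ n f ≈ 0#
  ∑-zero n f f≈0 = trans (∑-cong-≤ n f≈0) (∑-0# n)
    where
    ∑-0# : ∀ n → ∑ n (λ _ → 0#) ≈ 0#
    ∑-0# zero = refl
    ∑-0# (suc n) = trans (+-identityʳ _) (∑-0# n)

  ∑-suc-head : ∀ n f → ∑ (suc n) f ≈ f 0 + ∑ n (λ a → f (suc a))
  ∑-suc-head zero f = refl
  ∑-suc-head (suc n) f = trans (+-congʳ (∑-suc-head n f)) (+-assoc _ _ _)

  ∑-reverse : ∀ n f → ∑ n f ≈ ∑ n (λ a → f (n ∸ a))
  ∑-reverse zero f = refl
  ∑-reverse (suc n) f = begin
    ∑ n f + f (suc n)                   ≈⟨ +-congʳ (∑-reverse n f) ⟩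
    ∑ n (λ a → f (n ∸ a)) + f (suc n)   ≈⟨ +-comm _ _ ⟩
    f (suc n) + ∑ n (λ a → f (n ∸ a))   ≈⟨ ∑-suc-head n (λ a → f (suc n ∸ a)) ⟨
    ∑ (suc n) (λ a → f (suc n ∸ a))     ∎

  ∑-comm : ∀ n m (F : ℕ → ℕ → Carrier) → ∑ n (λ a → ∑ m (F a)) ≈ ∑ m (λ b → ∑ n (λ a → F a b))
  ∑-comm zero m F = refl
  ∑-comm (suc n) m F = trans (+-congʳ (∑-comm n m F)) (sym (∑-distrib-+ m _ _))

  ∑-triangle : ∀ n (F : ℕ → ℕ → Carrier) →
    ∑ n (λ a → ∑ a (F a)) ≈ ∑ n (λ b → ∑ (n ∸ b) (λ c → F (b +ℕ c) b))
  ∑-triangle zero F = refl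
  ∑-triangle (suc n) F = begin
    ∑ n (λ a → ∑ a (F a)) + (∑ n (F (suc n)) + F (suc n) (suc n))
      ≈⟨ +-congʳ (∑-triangle n F) ⟩
    ∑ n (λ b → ∑ (n ∸ b) (λ c → F (b +ℕ c) b)) + (∑ n (F (suc n)) + F (suc n) (suc n))
      ≈⟨ +-assoc _ _ _ ⟨
    (∑ n (λ b → ∑ (n ∸ b) (λ c → F (b +ℕ c) b)) + ∑ n (F (suc n))) + F (suc n) (suc n)
      ≈⟨ +-cong (∑-distrib-+ n _ _) (reflexive (cong (λ m → F m (suc n)) (ℕ.+-identityʳ (suc n)))) ⟨
    ∑ n (λ b → ∑ (n ∸ b) (λ c → F (b +ℕ c) b) + F (suc n) b) + F (suc n +ℕ 0) (suc n)
      ≈⟨ +-cong (∑-cong-≤ n (λ b b≤n → sym (extend-row b b≤n)))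
                (reflexive (cong (λ m → ∑ m (λ c → F (suc n +ℕ c) (suc n))) (≡-sym (ℕ.n∸n≡0 n)))) ⟩
    ∑ n (λ b → ∑ (suc n ∸ b) (λ c → F (b +ℕ c) b)) + ∑ (n ∸ n) (λ c → F (suc n +ℕ c) (suc n)) ∎
    where
    extend-row : ∀ b → b ≤ n →
      ∑ (suc n ∸ b) (λ c → F (b +ℕ c) b) ≈ ∑ (n ∸ b) (λ c → F (b +ℕ c) b) + F (suc n) b
    extend-row b b≤n rewrite ℕ.+-∸-assoc 1 b≤n =
      +-congˡ (reflexive (cong (λ m → F m b) (≡-trans (ℕ.+-suc b (n ∸ b)) (cong suc (ℕ.m+[n∸m]≡n b≤n)))))

  ∑-extend : ∀ n N f → n ≤ N → (∀ m → n < m → m ≤ N → f m ≈ 0#) → ∑ n f ≈ ∑ N f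
  ∑-extend .0 zero f z≤n _ = refl
  ∑-extend n (suc N) f n≤1+N f≈0 with ℕ.m≤n⇒m<n∨m≡n n≤1+N
  ... | inj₂ ≡-refl = refl
  ... | inj₁ (s≤s n≤N) = begin
    ∑ n f             ≈⟨ ∑-extend n N f n≤N (λ m n<m m≤N → f≈0 m n<m (ℕ.m≤n⇒m≤1+n m≤N)) ⟩
    ∑ N f             ≈⟨ +-identityʳ _ ⟨
    ∑ N f + 0#        ≈⟨ +-congˡ (f≈0 (suc N) (s≤s n≤N) ℕ.≤-refl) ⟨
    ∑ N f + f (suc N) ∎

  geometric-sum : ∀ h N → (1# - h) * ∑ N (h ^_) ≈ 1# - h ^ suc N
  geometric-sum h zero = trans (*-identityʳ _) (+-congˡ (-‿cong (sym (*-identityʳ h))))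
  geometric-sum h (suc N) = begin
    (1# - h) * (∑ N (h ^_) + h ^ suc N)               ≈⟨ distribˡ _ _ _ ⟩
    (1# - h) * ∑ N (h ^_) + (1# - h) * h ^ suc N      ≈⟨ +-cong (geometric-sum h N) (*-comm _ _) ⟩
    (1# - h ^ suc N) + h ^ suc N * (1# - h)           ≈⟨ +-congˡ (x[y-z]≈xy-xz _ _ _) ⟩
    (1# - h ^ suc N) + (h ^ suc N * 1# - h ^ suc N * h) ≈⟨ +-congˡ (+-cong (*-identityʳ _) (-‿cong (*-comm _ _))) ⟩
    (1# - h ^ suc N) + (h ^ suc N - h ^ suc (suc N))    ≈⟨ telescope 1# (h ^ suc N) _ ⟩
    1# - h ^ suc (suc N)                              ∎
    where
    telescope : ∀ x y z → (x - y) + (y - z) ≈ x - z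
    telescope x y z = begin
      (x - y) + (y - z)   ≈⟨ +-assoc _ _ _ ⟩
      x + (- y + (y - z)) ≈⟨ +-congˡ (+-assoc _ _ _) ⟨
      x + ((- y + y) - z) ≈⟨ +-congˡ (+-congʳ (-‿inverseˡ y)) ⟩
      x + (0# - z)        ≈⟨ +-congˡ (+-identityˡ _) ⟩
      x - z               ∎

module FormalPowerSeries {c ℓ} (R : CommutativeRing c ℓ) where
  open CommutativeRing R
  open SetoidReasoning setoid
  open FiniteSums R

  Series : Set c
  Series = ℕ → Carrier

  infix 4 _≋_
  _≋_ : Series → Series → Set ℓ
  u ≋ v = ∀ n → u n ≈ v n

  infixl 7 _⋆_
  _⋆_ : Series → Series → Series
  (u ⋆ v) n = ∑ n (λ a → u a * v (n ∸ a))

  const : Carrier → Series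
  const x zero = x
  const x (suc _) = 0#

  𝟙 : Series
  𝟙 = const 1#

  const-⋆ : ∀ x u → const x ⋆ u ≋ (λ n → x * u n)
  const-⋆ x u zero = refl
  const-⋆ x u (suc n) = begin
    (const x ⋆ u) (suc n)                       ≈⟨ ∑-suc-head n _ ⟩
    x * u (suc n) + ∑ n (λ a → 0# * u (n ∸ a)) ≈⟨ +-congˡ (∑-zero n _ (λ a _ → zeroˡ _)) ⟩
    x * u (suc n) + 0#                          ≈⟨ +-identityʳ _ ⟩
    x * u (suc n)                               ∎

  ⋆-cong : ∀ {u u′ v v′} → u ≋ u′ → v ≋ v′ → u ⋆ v ≋ u′ ⋆ v′
  ⋆-cong u≋u′ v≋v′ n = ∑-cong n (λ a → *-cong (u≋u′ a) (v≋v′ (n ∸ a)))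

  ⋆-comm : ∀ u v → u ⋆ v ≋ v ⋆ u
  ⋆-comm u v n = trans (∑-reverse n _)
    (∑-cong-≤ n (λ a a≤n → trans (*-comm _ _) (*-congʳ (reflexive (cong v (ℕ.m∸[m∸n]≡n a≤n))))))

  ⋆-assoc : ∀ u v w → (u ⋆ v) ⋆ w ≋ u ⋆ (v ⋆ w)
  ⋆-assoc u v w n = begin
    ∑ n (λ a → ∑ a (λ b → u b * v (a ∸ b)) * w (n ∸ a))
      ≈⟨ ∑-cong n (λ a → *-distribʳ-∑ a _ _) ⟩
    ∑ n (λ a → ∑ a (λ b → u b * v (a ∸ b) * w (n ∸ a)))
      ≈⟨ ∑-triangle n _ ⟩
    ∑ n (λ b → ∑ (n ∸ b) (λ c → u b * v (b +ℕ c ∸ b) * w (n ∸ (b +ℕ c))))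
      ≈⟨ ∑-cong n (λ b → ∑-cong (n ∸ b) (λ c → trans (*-assoc _ _ _) (*-congˡ (*-cong
           (reflexive (cong v (ℕ.m+n∸m≡n b c))) (reflexive (cong w (≡-sym (ℕ.∸-+-assoc n b c)))))))) ⟩
    ∑ n (λ b → ∑ (n ∸ b) (λ c → u b * (v c * w (n ∸ b ∸ c))))
      ≈⟨ ∑-cong n (λ b → *-distribˡ-∑ (n ∸ b) _ _) ⟨
    ∑ n (λ b → u b * ∑ (n ∸ b) (λ c → v c * w (n ∸ b ∸ c))) ∎

  ⋆-distribˡ : ∀ u v w → u ⋆ (λ n → v n + w n) ≋ (λ n → (u ⋆ v) n + (u ⋆ w) n)
  ⋆-distribˡ u v w n = trans (∑-cong n (λ a → distribˡ _ _ _)) (∑-distrib-+ n _ _)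

  ⋆-distribʳ : ∀ u v w → (λ n → v n + w n) ⋆ u ≋ (λ n → (v ⋆ u) n + (w ⋆ u) n)
  ⋆-distribʳ u v w n = trans (∑-cong n (λ a → distribʳ _ _ _)) (∑-distrib-+ n _ _)

  ⋆-identityˡ : ∀ u → 𝟙 ⋆ u ≋ u
  ⋆-identityˡ u n = trans (const-⋆ 1# u n) (*-identityˡ _)

  ⋆-identityʳ : ∀ u → u ⋆ 𝟙 ≋ u
  ⋆-identityʳ u n = trans (⋆-comm u 𝟙 n) (⋆-identityˡ u n)

  seriesRing : CommutativeRing c ℓ
  seriesRing = record
    { Carrier = Series
    ; _≈_ = _≋_
    ; _+_ = λ u v n → u n + v n
    ; _*_ = _⋆_
    ; -_ = λ u n → - u n
    ; 0# = λ _ → 0#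
    ; 1# = 𝟙
    ; isCommutativeRing = record
      { isRing = record
        { +-isAbelianGroup = Pointwise.isAbelianGroup ℕ +-isAbelianGroup
        ; *-cong = ⋆-cong
        ; *-assoc = ⋆-assoc
        ; *-identity = ⋆-identityˡ , ⋆-identityʳ
        ; distrib = ⋆-distribˡ , ⋆-distribʳ
        }
      ; *-comm = ⋆-comm
      }
    }

  ∑-coefficient : ∀ N (F : ℕ → Series) n → FiniteSums.∑ seriesRing N F n ≈ ∑ N (λ m → F m n)
  ∑-coefficient zero F n = refl
  ∑-coefficient (suc N) F n = +-congʳ (∑-coefficient N F n)

  shift : ℕ → Series → Series
  shift m u n = if m ≤ᵇ n then u (n ∸ m) else 0#

  shift-suc : ∀ m u n → shift (suc m) u (suc n) ≡ shift m u n
  shift-suc zero u n = ≡-refl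
  shift-suc (suc m) u n = ≡-refl

  shift-below : ∀ m u n → n < m → shift m u n ≈ 0#
  shift-below (suc m) u zero _ = refl
  shift-below (suc m) u (suc n) (s≤s n<m) = trans (reflexive (shift-suc m u n)) (shift-below m u n n<m)

  shift-cong : ∀ m {u v} → u ≋ v → shift m u ≋ shift m v
  shift-cong m u≋v n with m ≤ᵇ n
  ... | true = u≋v (n ∸ m)
  ... | false = refl

  shift-0# : ∀ m → shift m (λ _ → 0#) ≋ (λ _ → 0#)
  shift-0# m n = reflexive (if-eta (m ≤ᵇ n))

  shift-+ : ∀ m u v → shift m (λ n → u n + v n) ≋ (λ n → shift m u n + shift m v n)
  shift-+ m u v n with m ≤ᵇ n
  ... | true = refl
  ... | false = sym (+-identityʳ _)

  shift-‿ : ∀ m u → shift m (λ n → - u n) ≋ (λ n → - shift m u n)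
  shift-‿ m u n with m ≤ᵇ n
  ... | true = refl
  ... | false = sym -0#≈0#
    where open RingProperties ring using (-0#≈0#)

  shift-𝟙 : ∀ m n → shift m 𝟙 n ≡ (if n ≡ᵇ m then 1# else 0#)
  shift-𝟙 zero zero = ≡-refl
  shift-𝟙 zero (suc n) = ≡-refl
  shift-𝟙 (suc m) zero = ≡-refl
  shift-𝟙 (suc m) (suc n) = ≡-trans (shift-suc m 𝟙 n) (shift-𝟙 m n)

  shift-𝟙-⋆ : ∀ m u → shift m 𝟙 ⋆ u ≋ shift m u
  shift-𝟙-⋆ zero u n = ⋆-identityˡ u n
  shift-𝟙-⋆ (suc m) u zero = zeroˡ _
  shift-𝟙-⋆ (suc m) u (suc n) = begin
    (shift (suc m) 𝟙 ⋆ u) (suc n)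
      ≈⟨ ∑-suc-head n _ ⟩
    0# * u (suc n) + ∑ n (λ a → shift (suc m) 𝟙 (suc a) * u (n ∸ a))
      ≈⟨ +-cong (zeroˡ _) (∑-cong n (λ a → *-congʳ (reflexive (shift-suc m 𝟙 a)))) ⟩
    0# + (shift m 𝟙 ⋆ u) n
      ≈⟨ +-identityˡ _ ⟩
    (shift m 𝟙 ⋆ u) n
      ≈⟨ shift-𝟙-⋆ m u n ⟩
    shift m u n
      ≡⟨ shift-suc m u n ⟨
    shift (suc m) u (suc n) ∎

  shift-shift : ∀ m k u → shift m (shift k u) ≋ shift (m +ℕ k) u
  shift-shift zero k u n = refl
  shift-shift (suc m) k u zero = refl
  shift-shift (suc m) k u (suc n) = begin
    shift (suc m) (shift k u) (suc n) ≡⟨ shift-suc m (shift k u) n ⟩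
    shift m (shift k u) n             ≈⟨ shift-shift m k u n ⟩
    shift (m +ℕ k) u n                ≡⟨ shift-suc (m +ℕ k) u n ⟨
    shift (suc m +ℕ k) u (suc n)      ∎

  open CommutativeSemigroupProperties (CommutativeRing.*-commutativeSemigroup seriesRing)
    using () renaming (interchange to ⋆-interchange)

  shift-⋆ : ∀ m k u v → shift m u ⋆ shift k v ≋ shift (m +ℕ k) (u ⋆ v)
  shift-⋆ m k u v n = begin
    (shift m u ⋆ shift k v) n             ≈⟨ ⋆-cong (λ i → sym (shift-𝟙-⋆ m u i)) (λ i → sym (shift-𝟙-⋆ k v i)) n ⟩
    ((shift m 𝟙 ⋆ u) ⋆ (shift k 𝟙 ⋆ v)) n ≈⟨ ⋆-interchange (shift m 𝟙) u (shift k 𝟙) v n ⟩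
    ((shift m 𝟙 ⋆ shift k 𝟙) ⋆ (u ⋆ v)) n ≈⟨ ⋆-cong (λ i → trans (shift-𝟙-⋆ m (shift k 𝟙) i) (shift-shift m k 𝟙 i)) (λ i → refl {(u ⋆ v) i}) n ⟩
    (shift (m +ℕ k) 𝟙 ⋆ (u ⋆ v)) n        ≈⟨ shift-𝟙-⋆ (m +ℕ k) (u ⋆ v) n ⟩
    shift (m +ℕ k) (u ⋆ v) n              ∎

module Bivariate {c ℓ} (R : CommutativeRing c ℓ) where
  module R = CommutativeRing R
  module Q = FormalPowerSeries R
  module T = FormalPowerSeries Q.seriesRing
  module Q-ring = CommutativeRing Q.seriesRing
  module ∑Q = FiniteSums Q.seriesRing
  open SetoidReasoning R.setoid
  open FiniteSums R using (∑; ∑-cong; ∑-cong-≤; ∑-zero; ∑-extend)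

  -- A j i is the coefficient of tʲ qⁱ.
  R[[q]][[t]] : CommutativeRing c ℓ
  R[[q]][[t]] = T.seriesRing

  open CommutativeRing R[[q]][[t]]
  open FiniteSums R[[q]][[t]] using (_^_; geometric-sum) renaming (∑ to ∑ᵀ)

  *-coefficient : ∀ A B j i → (A * B) j i R.≈ ∑ j (λ b → ∑ i (λ a → A b a R.* B (j ∸ b) (i ∸ a)))
  *-coefficient A B j i = Q.∑-coefficient j (λ b → A b Q.⋆ B (j ∸ b)) i

  *-coefficient-local : ∀ C A B j i → (∀ j′ i′ → j′ ≤ j → i′ ≤ i → A j′ i′ R.≈ B j′ i′) →
    (C * A) j i R.≈ (C * B) j i
  *-coefficient-local C A B j i A≈B = begin
    (C * A) j i                                                     ≈⟨ *-coefficient C A j i ⟩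
    ∑ j (λ b → ∑ i (λ a → C b a R.* A (j ∸ b) (i ∸ a)))            ≈⟨ ∑-cong j (λ b → ∑-cong i (λ a →
                                                                         R.*-congˡ (A≈B _ _ (ℕ.m∸n≤m j b) (ℕ.m∸n≤m i a)))) ⟩
    ∑ j (λ b → ∑ i (λ a → C b a R.* B (j ∸ b) (i ∸ a)))            ≈⟨ *-coefficient C B j i ⟨
    (C * B) j i                                                     ∎

  ^-coefficient-vanishes : ∀ A → A 0 0 R.≈ R.0# → ∀ m j i → i +ℕ j < m → (A ^ m) j i R.≈ R.0#
  ^-coefficient-vanishes A A₀₀≈0 (suc m) j i i+j<1+m = R.trans (*-coefficient A (A ^ m) j i)
      (∑-zero j _ (λ b b≤j → ∑-zero i _ (λ a a≤i → term j i b a b≤j a≤i i+j<1+m)))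
    where
    lower : ∀ {i j} a b → i +ℕ j < m → (i ∸ a) +ℕ (j ∸ b) < m
    lower {i} {j} a b = ℕ.≤-<-trans (ℕ.+-mono-≤ (ℕ.m∸n≤m i a) (ℕ.m∸n≤m j b))
    term : ∀ j i b a → b ≤ j → a ≤ i → i +ℕ j < suc m → A b a R.* (A ^ m) (j ∸ b) (i ∸ a) R.≈ R.0#
    term j i zero zero _ _ _ = R.trans (R.*-congʳ A₀₀≈0) (R.zeroˡ _)
    term (suc j) i (suc b) a _ _ i+1+j<1+m = R.trans (R.*-congˡ (^-coefficient-vanishes A A₀₀≈0 m (j ∸ b) (i ∸ a)
      (lower a b (ℕ.≤-trans (ℕ.≤-reflexive (≡-sym (ℕ.+-suc i j))) (s≤s⁻¹ i+1+j<1+m))))) (R.zeroʳ _)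
    term j (suc i) zero (suc a) _ _ (s≤s i+j<m) = R.trans (R.*-congˡ (^-coefficient-vanishes A A₀₀≈0 m j (i ∸ a)
      (lower a 0 i+j<m))) (R.zeroʳ _)

  -- ∑ₘ Hᵐ, truncated at m = i + j where the coefficient of tʲ qⁱ in Hᵐ starts to vanish
  geometric-series : Carrier → Carrier
  geometric-series H j i = ∑ (i +ℕ j) (λ m → (H ^ m) j i)

  geometric-series-inverse : ∀ H → H 0 0 R.≈ R.0# → (1# - H) * geometric-series H ≈ 1#
  geometric-series-inverse H H₀₀≈0 j i = begin
    ((1# - H) * geometric-series H) j i ≈⟨ *-coefficient-local (1# - H) _ (∑ᵀ N (H ^_)) j i truncation ⟩
    ((1# - H) * ∑ᵀ N (H ^_)) j i        ≈⟨ geometric-sum H N j i ⟩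
    1# j i R.- (H ^ suc N) j i           ≈⟨ R.+-congˡ (R.-‿cong (^-coefficient-vanishes H H₀₀≈0 (suc N) j i ℕ.≤-refl)) ⟩
    1# j i R.- R.0#                      ≈⟨ R.+-congˡ -0#≈0# ⟩
    1# j i R.+ R.0#                      ≈⟨ R.+-identityʳ _ ⟩
    1# j i                               ∎
    where
    open RingProperties R.ring using (-0#≈0#)
    N = i +ℕ j
    truncation : ∀ j′ i′ → j′ ≤ j → i′ ≤ i → geometric-series H j′ i′ R.≈ ∑ᵀ N (H ^_) j′ i′
    truncation j′ i′ j′≤j i′≤i = begin
      ∑ (i′ +ℕ j′) (λ m → (H ^ m) j′ i′) ≈⟨ ∑-extend (i′ +ℕ j′) N _ (ℕ.+-mono-≤ i′≤i j′≤j)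
                                               (λ m i′+j′<m _ → ^-coefficient-vanishes H H₀₀≈0 m j′ i′ i′+j′<m) ⟩
      ∑ N (λ m → (H ^ m) j′ i′)          ≈⟨ Q.∑-coefficient N (λ m → (H ^ m) j′) i′ ⟨
      ∑Q.∑ N (λ m → (H ^ m) j′) i′       ≈⟨ T.∑-coefficient N (H ^_) j′ i′ ⟨
      ∑ᵀ N (H ^_) j′ i′                  ∎

  -- σ k A (q, t) = A (q, qᵏ t)
  σ : ℕ → Carrier → Carrier
  σ k A j = Q.shift (k *ℕ j) (A j)

  σ-cong : ∀ k {A B} → A ≈ B → σ k A ≈ σ k B
  σ-cong k A≈B j = Q.shift-cong (k *ℕ j) (A≈B j)

  σ-+ : ∀ k A B → σ k (A + B) ≈ σ k A + σ k B
  σ-+ k A B j = Q.shift-+ (k *ℕ j) (A j) (B j)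

  σ-‿ : ∀ k A → σ k (- A) ≈ - σ k A
  σ-‿ k A j = Q.shift-‿ (k *ℕ j) (A j)

  σ-* : ∀ k A B → σ k (A * B) ≈ σ k A * σ k B
  σ-* k A B j = let module ≋ = SetoidReasoning Q-ring.setoid in
    ≋.begin
      Q.shift (k *ℕ j) (∑Q.∑ j (λ b → A b Q.⋆ B (j ∸ b)))
        ≋.≈⟨ Q.shift-𝟙-⋆ (k *ℕ j) ((A * B) j) ⟨
      Q.shift (k *ℕ j) Q.𝟙 Q.⋆ ∑Q.∑ j (λ b → A b Q.⋆ B (j ∸ b))
        ≋.≈⟨ ∑Q.*-distribˡ-∑ j _ _ ⟩
      ∑Q.∑ j (λ b → Q.shift (k *ℕ j) Q.𝟙 Q.⋆ (A b Q.⋆ B (j ∸ b)))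
        ≋.≈⟨ ∑Q.∑-cong-≤ j (λ b b≤j → Q-ring.trans (Q.shift-𝟙-⋆ (k *ℕ j) (A b Q.⋆ B (j ∸ b))) (split b b≤j)) ⟩
      ∑Q.∑ j (λ b → Q.shift (k *ℕ b) (A b) Q.⋆ Q.shift (k *ℕ (j ∸ b)) (B (j ∸ b)))
        ≋.∎
    where
    split : ∀ b → b ≤ j → Q.shift (k *ℕ j) (A b Q.⋆ B (j ∸ b)) Q.≋ Q.shift (k *ℕ b) (A b) Q.⋆ Q.shift (k *ℕ (j ∸ b)) (B (j ∸ b))
    split b b≤j i = R.trans (R.reflexive (cong (λ m → Q.shift m (A b Q.⋆ B (j ∸ b)) i) kj≡kb+k[j∸b]))
                            (R.sym (Q.shift-⋆ (k *ℕ b) (k *ℕ (j ∸ b)) (A b) (B (j ∸ b)) i))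
      where
      kj≡kb+k[j∸b] : k *ℕ j ≡ k *ℕ b +ℕ k *ℕ (j ∸ b)
      kj≡kb+k[j∸b] = ≡-trans (cong (k *ℕ_) (≡-sym (ℕ.m+[n∸m]≡n b≤j))) (ℕ.*-distribˡ-+ k b (j ∸ b))

  σ-constant-term : ∀ k A → σ k A 0 Q.≋ A 0
  σ-constant-term k A i rewrite ℕ.*-zeroʳ k = R.refl

  σ-t-constant : ∀ k A → (∀ j → A (suc j) Q.≋ (λ _ → R.0#)) → σ k A ≈ A
  σ-t-constant k A A≈0 zero = σ-constant-term k A
  σ-t-constant k A A≈0 (suc j) i = R.trans (Q.shift-cong (k *ℕ suc j) (A≈0 j) i)
    (R.trans (Q.shift-0# (k *ℕ suc j) i) (R.sym (A≈0 j i)))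

  σ-σ₁ : ∀ k A → σ k (σ 1 A) ≈ σ (suc k) A
  σ-σ₁ k A j i = R.trans (Q.shift-shift (k *ℕ j) (1 *ℕ j) (A j) i)
    (R.reflexive (cong (λ m → Q.shift m (A j) i) (≡-trans (cong (k *ℕ j +ℕ_) (ℕ.*-identityˡ j)) (ℕ.+-comm (k *ℕ j) j))))

  t q : Carrier
  t = T.shift 1 1#
  q = T.const (Q.shift 1 Q.𝟙)

  t-* : ∀ A → t * A ≈ T.shift 1 A
  t-* = T.shift-𝟙-⋆ 1

  [1-q]-* : ∀ A → (1# - q) * A ≈ A - (λ j → Q.shift 1 (A j))
  [1-q]-* A = trans ([y-z]x≈yx-zx A 1# q) (+-cong (*-identityˡ A) (-‿cong q-*))
    where
    open RingProperties ring using ([y-z]x≈yx-zx)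
    q-* : q * A ≈ (λ j → Q.shift 1 (A j))
    q-* j i = R.trans (T.const-⋆ (Q.shift 1 Q.𝟙) A j i) (Q.shift-𝟙-⋆ 1 (A j) i)

module Factorisation {c ℓ} (R : CommutativeRing c ℓ) (e : ℕ → CommutativeRing.Carrier R)
                     (e₀≈1 : CommutativeRing._≈_ R (e 0) (CommutativeRing.1# R)) where
  module P = PowerSeries R e
  open Bivariate R
  open CommutativeRing R[[q]][[t]]
  open FiniteSums R[[q]][[t]] using (_^_)
  open FiniteSums R using (∑; ∑-cong; ∑-comm)
  open SetoidReasoning setoid
  module ℛ = SetoidReasoning R.setoid

  open RingProperties ring using (⁻¹-anti-homo‿-; xyx⁻¹≈y; x[y-z]≈xy-xz; -‿distribʳ-*)
  open RingProperties R.ring using (-0#≈0#)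

  x-[x-y]≈y : ∀ x y → x - (x - y) ≈ y
  x-[x-y]≈y x y = begin
    x - (x - y) ≈⟨ +-congˡ (⁻¹-anti-homo‿- x y) ⟩
    x + (y - x) ≈⟨ +-assoc x y (- x) ⟨
    x + y - x   ≈⟨ xyx⁻¹≈y x y ⟩
    y           ∎

  swap : P.PS → Carrier
  swap f j i = f i j

  ∑≤≡∑ : ∀ n f → P.∑≤ n f ≡ ∑ n f
  ∑≤≡∑ zero f = ≡-refl
  ∑≤≡∑ (suc n) f = cong (R._+ f (suc n)) (∑≤≡∑ n f)

  swap-⊛ : ∀ f g → swap (f P.⊛ g) ≈ swap f * swap g
  swap-⊛ f g j i = ℛ.begin
    P.∑≤ i (λ a → P.∑≤ j (λ b → f a b R.* g (i ∸ a) (j ∸ b)))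
      ℛ.≡⟨ ∑≤≡∑ i _ ⟩
    ∑ i (λ a → P.∑≤ j (λ b → f a b R.* g (i ∸ a) (j ∸ b)))
      ℛ.≈⟨ ∑-cong i (λ a → R.reflexive (∑≤≡∑ j _)) ⟩
    ∑ i (λ a → ∑ j (λ b → f a b R.* g (i ∸ a) (j ∸ b)))
      ℛ.≈⟨ ∑-comm i j _ ⟩
    ∑ j (λ b → ∑ i (λ a → f a b R.* g (i ∸ a) (j ∸ b)))
      ℛ.≈⟨ *-coefficient (swap f) (swap g) j i ⟨
    (swap f * swap g) j i
      ℛ.∎

  swap-one : swap P.one ≈ 1#
  swap-one zero zero = R.refl
  swap-one zero (suc i) = R.refl
  swap-one (suc j) zero = R.refl
  swap-one (suc j) (suc i) = R.refl

  swap-pow : ∀ f m → swap (P.pow f m) ≈ swap f ^ m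
  swap-pow f zero = swap-one
  swap-pow f (suc m) = trans (swap-⊛ f (P.pow f m)) (*-congˡ (swap-pow f m))

  swap-inv : ∀ f → f 0 0 R.≈ R.1# → swap f * swap (P.inv f) ≈ 1#
  swap-inv f f₀₀≈1 = trans (*-cong f≈1-H inv≈geometric) (geometric-series-inverse H H₀₀≈0)
    where
    H = swap (P.one P.⊕ (P.⊝ f))
    H₀₀≈0 : H 0 0 R.≈ R.0#
    H₀₀≈0 = R.trans (R.+-congˡ (R.-‿cong f₀₀≈1)) (R.-‿inverseʳ R.1#)
    f≈1-H : swap f ≈ 1# - H
    f≈1-H = trans (sym (x-[x-y]≈y 1# (swap f))) (+-congˡ (-‿cong (+-congʳ (sym swap-one))))
    inv≈geometric : swap (P.inv f) ≈ geometric-series H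
    inv≈geometric j i = R.trans (R.reflexive (∑≤≡∑ (i +ℕ j) _)) (∑-cong (i +ℕ j) (λ m → swap-pow (P.one P.⊕ (P.⊝ f)) m j i))

  swap-subst : ∀ k x f → swap (P.subst k x f) ≈ σ k (λ j i → x P.^ᴿ j R.* f i j)
  swap-subst k x f j i = R.refl

  swap-qᵏt : ∀ k → swap (P.mono k 1) ≈ σ k t
  swap-qᵏt k zero i = R.trans (R.reflexive (if-eta (i ≡ᵇ k))) (R.sym (Q.shift-0# (k *ℕ 0) i))
  swap-qᵏt k (suc zero) i = R.reflexive (≡-sym (≡-trans (cong (λ m → Q.shift m Q.𝟙 i) (ℕ.*-identityʳ k)) (Q.shift-𝟙 k i)))
  swap-qᵏt k (suc (suc j)) i = R.trans (R.reflexive (if-eta (i ≡ᵇ k))) (R.sym (Q.shift-0# (k *ℕ suc (suc j)) i))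

  swap-q : swap (P.mono 1 0) ≈ q
  swap-q zero i = R.reflexive (≡-sym (Q.shift-𝟙 1 i))
  swap-q (suc j) i = R.reflexive (if-eta (i ≡ᵇ 1))

  swap-1-q : swap P.oneMinusQ ≈ 1# - q
  swap-1-q = +-cong swap-one (-‿cong swap-q)

  Ê DqÊ DqÊ/Ê F₀ : Carrier
  Ê = swap P.E
  DqÊ = swap P.DqE
  DqÊ/Ê = swap P.DqE/E
  F₀ = 1# - (1# - q) * (t * DqÊ/Ê)

  Ê-const : ∀ j → Ê j Q.≋ Q.const (e j)
  Ê-const j zero = R.refl
  Ê-const j (suc i) = R.refl

  [i<n]x-[i<n+1]x≈-[i≡n]x : ∀ x n i → x R.* P.qint n i R.- x R.* P.qint (suc n) i R.≈ R.- Q.shift n (Q.const x) i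
  [i<n]x-[i<n+1]x≈-[i≡n]x x zero zero = R.trans (R.+-cong (R.zeroʳ x) (R.-‿cong (R.*-identityʳ x))) (R.+-identityˡ _)
  [i<n]x-[i<n+1]x≈-[i≡n]x x zero (suc i) = R.trans (R.-‿inverseʳ _) (R.sym -0#≈0#)
  [i<n]x-[i<n+1]x≈-[i≡n]x x (suc n) zero = R.trans (R.-‿inverseʳ _) (R.sym -0#≈0#)
  [i<n]x-[i<n+1]x≈-[i≡n]x x (suc n) (suc i) =
    R.trans ([i<n]x-[i<n+1]x≈-[i≡n]x x n i) (R.-‿cong (R.reflexive (≡-sym (Q.shift-suc n (Q.const x) i))))

  [1-q][n+1]qx≈[1-qⁿ⁺¹]x : ∀ x n i →
    x R.* P.qint (suc n) i R.- Q.shift 1 (λ i′ → x R.* P.qint (suc n) i′) i R.≈ Q.const x i R.- Q.shift (suc n) (Q.const x) i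
  [1-q][n+1]qx≈[1-qⁿ⁺¹]x x n zero = R.+-congʳ (R.*-identityʳ x)
  [1-q][n+1]qx≈[1-qⁿ⁺¹]x x n (suc i) = ℛ.begin
    x R.* P.qint n i R.- x R.* P.qint (suc n) i   ℛ.≈⟨ [i<n]x-[i<n+1]x≈-[i≡n]x x n i ⟩
    R.- Q.shift n (Q.const x) i                    ℛ.≡⟨ cong R.-_ (Q.shift-suc n (Q.const x) i) ⟨
    R.- Q.shift (suc n) (Q.const x) (suc i)        ℛ.≈⟨ R.+-identityˡ _ ⟨
    R.0# R.- Q.shift (suc n) (Q.const x) (suc i)   ℛ.∎

  q-difference : (1# - q) * (t * DqÊ) ≈ Ê - σ 1 Ê
  q-difference = begin
    (1# - q) * (t * DqÊ)                                  ≈⟨ [1-q]-* (t * DqÊ) ⟩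
    t * DqÊ - (λ j → Q.shift 1 ((t * DqÊ) j))             ≈⟨ +-cong (t-* DqÊ) (-‿cong (λ j → Q.shift-cong 1 (t-* DqÊ j))) ⟩
    T.shift 1 DqÊ - (λ j → Q.shift 1 (T.shift 1 DqÊ j))   ≈⟨ coefficientwise ⟩
    Ê - σ 1 Ê                                             ∎
    where
    coefficientwise : T.shift 1 DqÊ - (λ j → Q.shift 1 (T.shift 1 DqÊ j)) ≈ Ê - σ 1 Ê
    coefficientwise zero i = R.trans (R.+-congˡ (R.-‿cong (Q.shift-0# 1 i)))
      (R.trans (R.-‿inverseʳ R.0#) (R.sym (R.-‿inverseʳ (Ê 0 i))))
    coefficientwise (suc j) i = R.trans ([1-q][n+1]qx≈[1-qⁿ⁺¹]x (e (suc j)) j i)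
      (R.+-cong (R.sym (Ê-const (suc j) i)) (R.-‿cong (R.trans
        (Q.shift-cong (suc j) (λ i′ → R.sym (Ê-const (suc j) i′)) i)
        (R.reflexive (cong (λ m → Q.shift m (Ê (suc j)) i) (≡-sym (ℕ.*-identityˡ (suc j))))))))

  Ê*F₀≈σ₁Ê : Ê * F₀ ≈ σ 1 Ê
  Ê*F₀≈σ₁Ê = begin
    Ê * (1# - (1# - q) * (t * DqÊ/Ê))        ≈⟨ x[y-z]≈xy-xz Ê 1# ((1# - q) * (t * DqÊ/Ê)) ⟩
    Ê * 1# - Ê * ((1# - q) * (t * DqÊ/Ê))    ≈⟨ +-cong (*-identityʳ Ê) (-‿cong (*-congˡ (*-congˡ (*-congˡ (swap-⊛ P.DqE (P.inv P.E)))))) ⟩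
    Ê - Ê * ((1# - q) * (t * (DqÊ * Î)))     ≈⟨ +-congˡ (-‿cong (rearrange Ê (1# - q) t DqÊ Î)) ⟩
    Ê - ((1# - q) * (t * DqÊ)) * (Ê * Î)     ≈⟨ +-congˡ (-‿cong (*-cong q-difference (swap-inv P.E e₀≈1))) ⟩
    Ê - (Ê - σ 1 Ê) * 1#                     ≈⟨ +-congˡ (-‿cong (*-identityʳ _)) ⟩
    Ê - (Ê - σ 1 Ê)                          ≈⟨ x-[x-y]≈y Ê (σ 1 Ê) ⟩
    σ 1 Ê                                    ∎
    where
    Î = swap (P.inv P.E)
    open import Algebra.Solver.CommutativeMonoid *-commutativeMonoid using (solve; _⊕_; _⊜_)
    rearrange : ∀ x a b d y → x * (a * (b * (d * y))) ≈ (a * (b * d)) * (x * y)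
    rearrange = solve 5 (λ x a b d y → x ⊕ (a ⊕ (b ⊕ (d ⊕ y))) ⊜ (a ⊕ (b ⊕ d)) ⊕ (x ⊕ y)) refl

  -1ʲ*-1ʲ≈1 : ∀ j → (R.- R.1#) P.^ᴿ j R.* (R.- R.1#) P.^ᴿ j R.≈ R.1#
  -1ʲ*-1ʲ≈1 zero = R.*-identityʳ R.1#
  -1ʲ*-1ʲ≈1 (suc j) = R.trans (*-interchangeᴿ _ _ _ _) (R.trans (R.*-cong (-1*-1≈1) (-1ʲ*-1ʲ≈1 j)) (R.*-identityʳ R.1#))
    where
    open CommutativeSemigroupProperties R.*-commutativeSemigroup using () renaming (interchange to *-interchangeᴿ)
    open RingProperties R.ring using (-1*x≈-x; -‿involutive)
    -1*-1≈1 : R.- R.1# R.* R.- R.1# R.≈ R.1#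
    -1*-1≈1 = R.trans (-1*x≈-x (R.- R.1#)) (-‿involutive R.1#)

  pq[-t]≈DqÊ/Ê : (λ j i → (R.- R.1#) P.^ᴿ j R.* P.pq i j) ≈ DqÊ/Ê
  pq[-t]≈DqÊ/Ê j i = R.trans (R.sym (R.*-assoc _ _ _)) (R.trans (R.*-congʳ (-1ʲ*-1ʲ≈1 j)) (R.*-identityˡ _))

  Pser[-t]≈-tDqÊ/Ê : (λ j i → (R.- R.1#) P.^ᴿ j R.* P.Pser i j) ≈ - (t * DqÊ/Ê)
  Pser[-t]≈-tDqÊ/Ê zero i = R.trans (R.zeroʳ _) (R.sym (R.trans (R.-‿cong (t-* DqÊ/Ê 0 i)) -0#≈0#))
  Pser[-t]≈-tDqÊ/Ê (suc j) i = R.trans (R.*-assoc _ _ _) (R.trans (-1*x≈-x _)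
    (R.-‿cong (R.trans (pq[-t]≈DqÊ/Ê j i) (R.sym (t-* DqÊ/Ê (suc j) i)))))
    where open RingProperties R.ring using (-1*x≈-x)

  σ-F₀ : ∀ k → σ k F₀ ≈ 1# - (1# - q) * (σ k t * σ k DqÊ/Ê)
  σ-F₀ k = begin
    σ k (1# - (1# - q) * (t * DqÊ/Ê))           ≈⟨ σ-+ k 1# (- ((1# - q) * (t * DqÊ/Ê))) ⟩
    σ k 1# + σ k (- ((1# - q) * (t * DqÊ/Ê)))   ≈⟨ +-cong (σ-t-constant k 1# (λ _ _ → R.refl)) (σ-‿ k ((1# - q) * (t * DqÊ/Ê))) ⟩
    1# - σ k ((1# - q) * (t * DqÊ/Ê))           ≈⟨ +-congˡ (-‿cong (σ-* k (1# - q) (t * DqÊ/Ê))) ⟩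
    1# - σ k (1# - q) * σ k (t * DqÊ/Ê)         ≈⟨ +-congˡ (-‿cong (*-cong (σ-t-constant k (1# - q) (λ _ _ → R.-‿inverseʳ R.0#))
                                                                           (σ-* k t DqÊ/Ê))) ⟩
    1# - (1# - q) * (σ k t * σ k DqÊ/Ê)         ∎

  swap-F : ∀ k → swap (P.F k) ≈ σ k F₀
  swap-F k = begin
    swap P.one - swap (P.oneMinusQ P.⊛ (P.mono k 1 P.⊛ P.subst k (R.- R.1#) P.pq))
      ≈⟨ +-cong swap-one (-‿cong (trans (swap-⊛ P.oneMinusQ (P.mono k 1 P.⊛ P.subst k (R.- R.1#) P.pq)) (*-cong swap-1-q (trans (swap-⊛ (P.mono k 1) (P.subst k (R.- R.1#) P.pq))
           (*-cong (swap-qᵏt k) (trans (swap-subst k (R.- R.1#) P.pq) (σ-cong k pq[-t]≈DqÊ/Ê))))))) ⟩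
    1# - (1# - q) * (σ k t * σ k DqÊ/Ê)
      ≈⟨ σ-F₀ k ⟨
    σ k F₀ ∎

  swap-G : ∀ k → swap (P.G k) ≈ σ k F₀
  swap-G k = begin
    swap P.one + swap (P.oneMinusQ P.⊛ P.subst k (R.- R.1#) P.Pser)
      ≈⟨ +-cong swap-one (trans (swap-⊛ P.oneMinusQ (P.subst k (R.- R.1#) P.Pser)) (*-cong swap-1-q (trans (swap-subst k (R.- R.1#) P.Pser) (σ-cong k Pser[-t]≈-tDqÊ/Ê)))) ⟩
    1# + (1# - q) * σ k (- (t * DqÊ/Ê))
      ≈⟨ +-congˡ (*-congˡ (trans (σ-‿ k (t * DqÊ/Ê)) (-‿cong (σ-* k t DqÊ/Ê)))) ⟩
    1# + (1# - q) * - (σ k t * σ k DqÊ/Ê)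
      ≈⟨ +-congˡ (-‿distribʳ-* (1# - q) (σ k t * σ k DqÊ/Ê)) ⟨
    1# - (1# - q) * (σ k t * σ k DqÊ/Ê)
      ≈⟨ σ-F₀ k ⟨
    σ k F₀ ∎

  F₀-constant-term : F₀ 0 0 R.≈ R.1#
  F₀-constant-term = R.trans (R.+-congˡ (R.trans (R.-‿cong (R.trans (R.*-congˡ (R.zeroˡ _)) (R.zeroʳ _))) -0#≈0#))
    (R.+-identityʳ R.1#)

  σᴷÊ≈1-below-qᴷ : ∀ K j i → i < K → σ K Ê j i R.≈ 1# j i
  σᴷÊ≈1-below-qᴷ K zero zero _ = R.trans (σ-constant-term K Ê 0) e₀≈1
  σᴷÊ≈1-below-qᴷ K zero (suc i) _ = σ-constant-term K Ê (suc i)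
  σᴷÊ≈1-below-qᴷ K (suc j) i i<K = Q.shift-below (K *ℕ suc j) (Ê (suc j)) i (ℕ.<-≤-trans i<K (ℕ.m≤m*n K (suc j)))

  module Telescoping (Φ : ℕ → P.PS) (swap-Φ : ∀ k → swap (Φ k) ≈ σ k F₀) where
    Π : ℕ → P.PS
    Π = P.prod (λ k → P.inv (Φ k))

    σᴷÊ*Φ≈σᴷ⁺¹Ê : ∀ K → σ K Ê * swap (Φ K) ≈ σ (suc K) Ê
    σᴷÊ*Φ≈σᴷ⁺¹Ê K = begin
      σ K Ê * swap (Φ K)  ≈⟨ *-congˡ (swap-Φ K) ⟩
      σ K Ê * σ K F₀      ≈⟨ σ-* K Ê F₀ ⟨
      σ K (Ê * F₀)        ≈⟨ σ-cong K Ê*F₀≈σ₁Ê ⟩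
      σ K (σ 1 Ê)         ≈⟨ σ-σ₁ K Ê ⟩
      σ (suc K) Ê         ∎

    Φ⁻¹Φ≈1 : ∀ K → swap (P.inv (Φ K)) * swap (Φ K) ≈ 1#
    Φ⁻¹Φ≈1 K = trans (*-comm (swap (P.inv (Φ K))) (swap (Φ K))) (swap-inv (Φ K) (R.trans (swap-Φ K 0 0)
      (R.trans (σ-constant-term K F₀ 0) F₀-constant-term)))

    Π*σᴷÊ≈Ê : ∀ K → swap (Π K) * σ K Ê ≈ Ê
    Π*σᴷÊ≈Ê zero = trans (*-congʳ {σ 0 Ê} swap-one) (*-identityˡ Ê)
    Π*σᴷÊ≈Ê (suc K) = begin
      swap (Π K P.⊛ P.inv (Φ K)) * σ (suc K) Ê
        ≈⟨ *-cong (swap-⊛ (Π K) (P.inv (Φ K))) (sym (σᴷÊ*Φ≈σᴷ⁺¹Ê K)) ⟩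
      (swap (Π K) * swap (P.inv (Φ K))) * (σ K Ê * swap (Φ K))
        ≈⟨ *-interchange (swap (Π K)) (swap (P.inv (Φ K))) (σ K Ê) (swap (Φ K)) ⟩
      (swap (Π K) * σ K Ê) * (swap (P.inv (Φ K)) * swap (Φ K))
        ≈⟨ *-cong (Π*σᴷÊ≈Ê K) (Φ⁻¹Φ≈1 K) ⟩
      Ê * 1#
        ≈⟨ *-identityʳ Ê ⟩
      Ê ∎
      where open CommutativeSemigroupProperties *-commutativeSemigroup using () renaming (interchange to *-interchange)

    Π-converges : P.ProdConvergesTo (λ k → P.inv (Φ k)) P.E
    Π-converges i j = suc i , λ K i<K → ℛ.begin
      Π K i j                     ℛ.≈⟨ *-identityʳ (swap (Π K)) j i ⟨
      (swap (Π K) * 1#) j i       ℛ.≈⟨ *-coefficient-local (swap (Π K)) 1# (σ K Ê) j i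
                                         (λ j′ i′ _ i′≤i → R.sym (σᴷÊ≈1-below-qᴷ K j′ i′ (ℕ.<-≤-trans (s≤s i′≤i) i<K))) ⟩
      (swap (Π K) * σ K Ê) j i    ℛ.≈⟨ Π*σᴷÊ≈Ê K j i ⟩
      P.E i j                     ℛ.∎

corollary8p3 : ∀ {c ℓ} (R : CommutativeRing c ℓ) (ι : ℚ → CommutativeRing.Carrier R)
    → IsQAlgebraStructure R ι
    → (e : ℕ → CommutativeRing.Carrier R)
    → CommutativeRing._≈_ R (e 0) (CommutativeRing.1# R)
    → PowerSeries.ProdConvergesTo R e (λ k → PowerSeries.inv R e (PowerSeries.F R e k)) (PowerSeries.E R e)
      × PowerSeries.ProdConvergesTo R e (λ k → PowerSeries.inv R e (PowerSeries.G R e k)) (PowerSeries.E R e)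
corollary8p3 R _ _ e e₀≈1 = Telescoping.Π-converges P.F swap-F , Telescoping.Π-converges P.G swap-G
  where open Factorisation R e e₀≈1
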